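{- For every matrix $M\in\mathrm{GL}(2,\mathbb{Z})$ there is a unique canonical word $w\in\Sigma^*$ such that $\phi(w)=M$.
   Context: $\mathrm{GL}(2,\mathbb{Z})$ is the group of $2\times 2$ integer matrices with determinant $\pm1$. Let $\Sigma=\{X,N,S,R\}$ and let $\phi:\Sigma^*\to\mathrm{GL}(2,\mathbb{Z})$ be the monoid morphism (empty word $\mapsto I$) determined by $\phi(X)=\begin{bmatrix}-1&0\\0&-1\end{bmatrix}$, $\phi(N)=\begin{bmatrix}1&0\\0&-1\end{bmatrix}$, $\phi(S)=\begin{bmatrix}0&-1\\1&0\end{bmatrix}$, $\phi(R)=\begin{bmatrix}0&-1\\1&1\end{bmatrix}$. For $V\in\Sigma$ and $n\ge 1$, $V^n$ is the word consisting of $n$ copies of $V$, and $V^0$ is the empty word. A word $w\in\Sigma^*$ is canonical if it has the form $w=N^\delta X^\gamma S^\beta R^{\alpha_0}SR^{\alpha_1}SR^{\alpha_2}\cdots SR^{\alpha_{n-1}}SR^{\alpha_n}$ with $n\ge 0$, $\beta,\gamma,\delta\in\{0,1\}$, $\alpha_0,\dots,\alpha_{n-1}\in\{1,2\}$ and $\alpha_n\in\{0,1,2\}$. -}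

module Defs where

open import Data.Integer using (ℤ; +_; -_; _*_; _-_; 0ℤ; 1ℤ)
open import Data.List using (List; []; _∷_; _++_; replicate; foldr)
open import Data.Nat using (ℕ; _<_)
open import Data.Product using (Σ; ∃; _×_; _,_)
open import Data.Sum using (_⊎_)
open import Relation.Binary.PropositionalEquality using (_≡_)

record Mat : Set where
  constructor mat
  field
    a b c d : ℤ

_·_ : Mat → Mat → Mat
mat a b c d · mat a' b' c' d' =
  mat (a * a' Data.Integer.+ b * c') (a * b' Data.Integer.+ b * d')
      (c * a' Data.Integer.+ d * c') (c * b' Data.Integer.+ d * d')

det : Mat → ℤ
det (mat a b c d) = a * d - b * c

I₂ : Mat
I₂ = mat 1ℤ 0ℤ 0ℤ 1ℤ

InGL2 : Mat → Set
InGL2 M = det M ≡ 1ℤ ⊎ det M ≡ - 1ℤ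

data Letter : Set where
  X N S R : Letter

Word : Set
Word = List Letter

φL : Letter → Mat
φL X = mat (- 1ℤ) 0ℤ 0ℤ (- 1ℤ)
φL N = mat 1ℤ 0ℤ 0ℤ (- 1ℤ)
φL S = mat 0ℤ (- 1ℤ) 1ℤ 0ℤ
φL R = mat 0ℤ (- 1ℤ) 1ℤ 1ℤ

φ : Word → Mat
φ [] = I₂
φ (l ∷ w) = φL l · φ w

pow : Letter → ℕ → Word
pow V n = replicate n V

sTail : List ℕ → Word
sTail [] = []
sTail (α ∷ αs) = S ∷ (pow R α ++ sTail αs)

data ValidExps : List ℕ → Set where
  last : ∀ {α} → α < 3 → ValidExps (α ∷ [])
  cons : ∀ {α αs} → 1 Data.Nat.≤ α → α < 3 → ValidExps αs → ValidExps (α ∷ αs)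

canonicalWord : ℕ → ℕ → ℕ → ℕ → List ℕ → Word
canonicalWord δ γ β α₀ αs = pow N δ ++ (pow X γ ++ (pow S β ++ (pow R α₀ ++ sTail αs)))

Canonical : Word → Set
Canonical w =
  Σ ℕ λ δ → Σ ℕ λ γ → Σ ℕ λ β → Σ ℕ λ α₀ → Σ (List ℕ) λ αs →
    δ < 2 × γ < 2 × β < 2 × ValidExps (α₀ ∷ αs) ×
    canonicalWord δ γ β α₀ αs ≡ w

-- SL(2,ℕ) is the free monoid on T = [[1,1],[0,1]] and U = [[1,0],[1,1]]: a unimodular matrix
-- with nonnegative entries other than I has one row dominating the other entrywise, and
-- subtracting it is the unique way to peel off a first generator.  Every M ∈ SL(2,ℤ) is then
-- ±R^j·Q·S^e with j < 3, Q ∈ SL(2,ℕ), e ∈ {0,1}, and uniquely so.  Existence: rotate by R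
-- until the first column lies in the sector x > 0, y ≥ 0 and read off the signs of the
-- second column.  Uniqueness: R acts on the signs of x, y and x + y of a column (x, y) by
-- rotating the six sectors cut out by the lines x = 0, y = 0 and x + y = 0, and these signs
-- for the two columns of ±R^j·Q·S^e determine ±, j and e.
-- Multiplying by N^δ, with δ read off from det M, covers GL(2,ℤ).  Finally S·R = -T and
-- S·R² = -U, so the canonical words N^δ X^γ S^β R^α₀ S R^α₁ ⋯ S R^αₙ are exactly these
-- factorisations written out letter by letter.
module Submission where

module SL₂ℕ where

  open import Data.Empty using (⊥-elim)
  open import Data.List using (List; []; _∷_)
  open import Data.Nat
  open import Data.Nat.Induction using (<-wellFounded)
  open import Data.Nat.Properties
  open import Data.Nat.Tactic.RingSolver using (solve-∀)
  open import Data.Product using (∃; _×_; _,_)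
  open import Data.Sum using (_⊎_; inj₁; inj₂)
  open import Function using (_on_)
  open import Induction.WellFounded using (Acc; acc)
  open import Relation.Binary.Construct.On using (wellFounded)
  open import Relation.Binary.PropositionalEquality
  open import Relation.Nullary using (yes; no; ¬_)

  record ℕMat : Set where
    constructor nmat
    field
      a b c d : ℕ

  Unimodular : ℕMat → Set
  Unimodular (nmat a b c d) = a * d ≡ suc (b * c)

  Iₙ : ℕMat
  Iₙ = nmat 1 0 0 1

  T·_ U·_ : ℕMat → ℕMat
  T· nmat a b c d = nmat (c + a) (d + b) c d
  U· nmat a b c d = nmat a b (a + c) (b + d)

  data Gen : Set where
    T U : Gen

  tuMat : List Gen → ℕMat
  tuMat []      = Iₙ
  tuMat (T ∷ P) = T· tuMat P
  tuMat (U ∷ P) = U· tuMat P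

  unimodular-diagonal : ∀ q → Unimodular q → 0 < ℕMat.a q × 0 < ℕMat.d q
  unimodular-diagonal (nmat zero    b c d)       ()
  unimodular-diagonal (nmat (suc a) b c zero)    u = ⊥-elim (0≢1+n (trans (sym (*-zeroʳ a)) u))
  unimodular-diagonal (nmat (suc a) b c (suc d)) u = z<s , z<s

  private
    T·-expandˡ : ∀ a c d → (c + a) * d ≡ c * d + a * d
    T·-expandˡ = solve-∀
    T·-expandʳ : ∀ b c d → suc ((d + b) * c) ≡ c * d + suc (b * c)
    T·-expandʳ = solve-∀
    U·-expandˡ : ∀ a b d → a * (b + d) ≡ a * b + a * d
    U·-expandˡ = solve-∀
    U·-expandʳ : ∀ a b c → suc (b * (a + c)) ≡ a * b + suc (b * c)
    U·-expandʳ = solve-∀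

  T·-unimodular : ∀ q → Unimodular q → Unimodular (T· q)
  T·-unimodular (nmat a b c d) u =
    trans (T·-expandˡ a c d) (trans (cong (c * d +_) u) (sym (T·-expandʳ b c d)))

  T·-unimodular⁻¹ : ∀ q → Unimodular (T· q) → Unimodular q
  T·-unimodular⁻¹ (nmat a b c d) u =
    +-cancelˡ-≡ (c * d) _ _ (trans (sym (T·-expandˡ a c d)) (trans u (T·-expandʳ b c d)))

  U·-unimodular : ∀ q → Unimodular q → Unimodular (U· q)
  U·-unimodular (nmat a b c d) u =
    trans (U·-expandˡ a b d) (trans (cong (a * b +_) u) (sym (U·-expandʳ a b c)))

  U·-unimodular⁻¹ : ∀ q → Unimodular (U· q) → Unimodular q
  U·-unimodular⁻¹ (nmat a b c d) u =
    +-cancelˡ-≡ (a * b) _ _ (trans (sym (U·-expandˡ a b d)) (trans u (U·-expandʳ a b c)))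

  tuMat-unimodular : ∀ P → Unimodular (tuMat P)
  tuMat-unimodular []      = refl
  tuMat-unimodular (T ∷ P) = T·-unimodular (tuMat P) (tuMat-unimodular P)
  tuMat-unimodular (U ∷ P) = U·-unimodular (tuMat P) (tuMat-unimodular P)

  T·-injective : ∀ q q' → T· q ≡ T· q' → q ≡ q'
  T·-injective (nmat a b c d) (nmat a' b' c' d') eq with cong ℕMat.c eq | cong ℕMat.d eq
  ... | refl | refl with +-cancelˡ-≡ c a a' (cong ℕMat.a eq) | +-cancelˡ-≡ d b b' (cong ℕMat.b eq)
  ... | refl | refl = refl

  U·-injective : ∀ q q' → U· q ≡ U· q' → q ≡ q'
  U·-injective (nmat a b c d) (nmat a' b' c' d') eq with cong ℕMat.a eq | cong ℕMat.b eq
  ... | refl | refl with +-cancelˡ-≡ a c c' (cong ℕMat.c eq) | +-cancelˡ-≡ b d d' (cong ℕMat.d eq)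
  ... | refl | refl = refl

  Iₙ≢T· : ∀ q → Iₙ ≢ T· q
  Iₙ≢T· (nmat a b c d) eq with cong ℕMat.d eq
  ... | refl = 0≢1+n (cong ℕMat.b eq)

  Iₙ≢U· : ∀ q → Iₙ ≢ U· q
  Iₙ≢U· (nmat a b c d) eq with cong ℕMat.a eq
  ... | refl = 0≢1+n (cong ℕMat.c eq)

  -- Comparing entries gives c = (c + a) + c', so a = 0, which unimodularity forbids.
  T·≢U· : ∀ q q' → Unimodular q → T· q ≢ U· q'
  T·≢U· (nmat a b c d) (nmat a' b' c' d') u eq with cong ℕMat.a eq
  ... | refl with unimodular-diagonal (nmat a b c d) u | m+n≡0⇒m≡0 a a+c'≡0
    where
    a+c'≡0 : a + c' ≡ 0
    a+c'≡0 = sym (+-cancelˡ-≡ c 0 (a + c')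
      (trans (+-identityʳ c) (trans (cong ℕMat.c eq) (+-assoc c a c'))))
  ... | () , _ | refl

  tuMat-injective : ∀ P Q → tuMat P ≡ tuMat Q → P ≡ Q
  tuMat-injective []      []      eq = refl
  tuMat-injective []      (T ∷ Q) eq = ⊥-elim (Iₙ≢T· (tuMat Q) eq)
  tuMat-injective []      (U ∷ Q) eq = ⊥-elim (Iₙ≢U· (tuMat Q) eq)
  tuMat-injective (T ∷ P) []      eq = ⊥-elim (Iₙ≢T· (tuMat P) (sym eq))
  tuMat-injective (U ∷ P) []      eq = ⊥-elim (Iₙ≢U· (tuMat P) (sym eq))
  tuMat-injective (T ∷ P) (U ∷ Q) eq = ⊥-elim (T·≢U· (tuMat P) (tuMat Q) (tuMat-unimodular P) eq)
  tuMat-injective (U ∷ P) (T ∷ Q) eq = ⊥-elim (T·≢U· (tuMat Q) (tuMat P) (tuMat-unimodular Q) (sym eq))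
  tuMat-injective (T ∷ P) (T ∷ Q) eq =
    cong (T ∷_) (tuMat-injective P Q (T·-injective (tuMat P) (tuMat Q) eq))
  tuMat-injective (U ∷ P) (U ∷ Q) eq =
    cong (U ∷_) (tuMat-injective P Q (U·-injective (tuMat P) (tuMat Q) eq))

  -- (c + 1)(b + 1) ≤ ad = bc + 1 leaves no room for b or c.
  unimodular-identity : ∀ {a b c d} → c < a → b < d → Unimodular (nmat a b c d) → nmat a b c d ≡ Iₙ
  unimodular-identity {a} {b} {c} {d} c<a b<d u with m+n≡0⇒m≡0 b b+c≡0 | m+n≡0⇒n≡0 b b+c≡0
    where
    b+c≡0 : b + c ≡ 0
    b+c≡0 = n≤0⇒n≡0 (+-cancelˡ-≤ (b * c) (b + c) 0 (≤-pred (begin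
      suc (b * c + (b + c)) ≡⟨ expand b c ⟩
      suc c * suc b         ≤⟨ *-mono-≤ c<a b<d ⟩
      a * d                 ≡⟨ u ⟩
      suc (b * c)           ≡⟨ cong suc (+-identityʳ (b * c)) ⟨
      suc (b * c + 0)       ∎)))
      where
      open ≤-Reasoning
      expand : ∀ b c → suc (b * c + (b + c)) ≡ suc c * suc b
      expand = solve-∀
  ... | refl | refl with m*n≡1⇒m≡1 a d u | m*n≡1⇒n≡1 a d u
  ... | refl | refl = refl

  unimodular-crossed : ∀ {a b c d} → a < c → d < b → ¬ Unimodular (nmat a b c d)
  unimodular-crossed {a} {b} {c} {d} a<c d<b u = <-irrefl refl (begin-strict
    b * c       <⟨ n<1+n (b * c) ⟩
    suc (b * c) ≡⟨ u ⟨
    a * d       ≤⟨ *-mono-≤ (<⇒≤ a<c) (<⇒≤ d<b) ⟩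
    c * b       ≡⟨ *-comm c b ⟩
    b * c       ∎)
    where open ≤-Reasoning

  data Peel (q : ℕMat) : Set where
    identity : q ≡ Iₙ → Peel q
    T-first  : ∀ q' → q ≡ T· q' → Peel q
    U-first  : ∀ q' → q ≡ U· q' → Peel q

  peel-T : ∀ {a b c d} → c ≤ a → d ≤ b → Peel (nmat a b c d)
  peel-T c≤a d≤b with m≤n⇒∃[o]m+o≡n c≤a | m≤n⇒∃[o]m+o≡n d≤b
  ... | x , refl | y , refl = T-first (nmat x y _ _) refl

  peel-U : ∀ {a b c d} → a ≤ c → b ≤ d → Peel (nmat a b c d)
  peel-U a≤c b≤d with m≤n⇒∃[o]m+o≡n a≤c | m≤n⇒∃[o]m+o≡n b≤d
  ... | x , refl | y , refl = U-first (nmat _ _ x y) refl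

  peel : ∀ q → Unimodular q → Peel q
  peel (nmat a b c d) u with c ≤? a | d ≤? b
  ... | yes c≤a | yes d≤b = peel-T c≤a d≤b
  ... | no c≰a  | no d≰b  = peel-U (<⇒≤ (≰⇒> c≰a)) (<⇒≤ (≰⇒> d≰b))
  ... | yes c≤a | no d≰b with a ≤? c
  ...   | yes a≤c = peel-U a≤c (<⇒≤ (≰⇒> d≰b))
  ...   | no a≰c  = identity (unimodular-identity (≰⇒> a≰c) (≰⇒> d≰b) u)
  peel (nmat a b c d) u | no c≰a | yes d≤b with b ≤? d
  ...   | yes b≤d = peel-U (<⇒≤ (≰⇒> c≰a)) b≤d
  ...   | no b≰d  = ⊥-elim (unimodular-crossed (≰⇒> c≰a) (≰⇒> b≰d) u)

  size : ℕMat → ℕ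
  size (nmat a b c d) = a + b + c + d

  size-T· : ∀ q → Unimodular q → size q < size (T· q)
  size-T· (nmat a b c d) u with unimodular-diagonal (nmat a b c d) u
  ... | _ , 0<d = begin-strict
    a + b + c + d             <⟨ m<m+n _ (<-≤-trans 0<d (m≤n+m d c)) ⟩
    a + b + c + d + (c + d)   ≡⟨ regroup a b c d ⟩
    c + a + (d + b) + c + d   ∎
    where
    open ≤-Reasoning
    regroup : ∀ a b c d → a + b + c + d + (c + d) ≡ c + a + (d + b) + c + d
    regroup = solve-∀

  size-U· : ∀ q → Unimodular q → size q < size (U· q)
  size-U· (nmat a b c d) u with unimodular-diagonal (nmat a b c d) u
  ... | 0<a , _ = begin-strict
    a + b + c + d             <⟨ m<m+n _ (<-≤-trans 0<a (m≤m+n a b)) ⟩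
    a + b + c + d + (a + b)   ≡⟨ regroup a b c d ⟩
    a + b + (a + c) + (b + d) ∎
    where
    open ≤-Reasoning
    regroup : ∀ a b c d → a + b + c + d + (a + b) ≡ a + b + (a + c) + (b + d)
    regroup = solve-∀

  tuMat-surjective : ∀ q → Unimodular q → ∃ λ P → tuMat P ≡ q
  tuMat-surjective q = go q (wellFounded size <-wellFounded q)
    where
    go : ∀ q → Acc (_<_ on size) q → Unimodular q → ∃ λ P → tuMat P ≡ q
    go q (acc smaller) u with peel q u
    ... | identity refl = [] , refl
    ... | T-first q' refl =
      let u' = T·-unimodular⁻¹ q' u ; P , e = go q' (smaller (size-T· q' u')) u' in T ∷ P , cong T·_ e
    ... | U-first q' refl =
      let u' = U·-unimodular⁻¹ q' u ; P , e = go q' (smaller (size-U· q' u')) u' in U ∷ P , cong U·_ e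

  sum-of-products≡1 : ∀ a b c d → suc a * d + suc b * c ≡ 1 →
                      (d ≡ 0 × c ≡ 1 × b ≡ 0) ⊎ (d ≡ 1 × c ≡ 0 × a ≡ 0)
  sum-of-products≡1 a b c zero h rewrite *-zeroʳ a =
    inj₁ (refl , m*n≡1⇒n≡1 (suc b) c h , suc-injective (m*n≡1⇒m≡1 (suc b) c h))
  sum-of-products≡1 a b c (suc d) h
    with m+n≡0⇒m≡0 (d + a * suc d) (suc-injective h) | m+n≡0⇒n≡0 (d + a * suc d) (suc-injective h)
  ... | d+ad≡0 | bc≡0 with m+n≡0⇒m≡0 d d+ad≡0 | m+n≡0⇒n≡0 d d+ad≡0 | m+n≡0⇒m≡0 c bc≡0
  ... | refl | a·1≡0 | refl = inj₂ (refl , refl , trans (sym (*-identityʳ a)) a·1≡0)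

open SL₂ℕ

open import Defs
open import Data.Bool using (Bool; true; false; not; _xor_)
import Data.Bool.Properties as Bool
open import Data.Bool.Properties using (xor-same; xor-assoc; xor-identityʳ)
open import Data.Empty using (⊥-elim)
open import Data.Fin using (Fin; toℕ)
open import Data.Fin.Patterns using (0F; 1F; 2F)
import Data.Fin.Properties as Fin
open import Data.Integer using (ℤ; +_; -[1+_]; -_; 0ℤ; 1ℤ; _+_; _*_; _-_)
open import Data.Integer.Properties using (+-injective; pos-*; neg-distrib-+; *-identityˡ)
open import Data.Integer.Tactic.RingSolver using (solve-∀)
open import Data.List using (List; []; _∷_; _++_; map)
open import Data.List.Properties using (++-assoc)
import Data.Nat as ℕ
open import Data.Product using (Σ; ∃; _×_; _,_; proj₁; proj₂)
open import Data.Product.Properties using (≡-dec)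
open import Data.Sum using (_⊎_; inj₁; inj₂)
open import Function using (_∘_)
open import Relation.Binary.Definitions using (DecidableEquality)
open import Relation.Binary.PropositionalEquality
open import Relation.Nullary using (¬_)
open import Relation.Nullary.Decidable using (Dec; yes; no; map′; _×-dec_; _→-dec_; toWitness)

mat-cong : ∀ {a b c d a' b' c' d'} → a ≡ a' → b ≡ b' → c ≡ c' → d ≡ d' →
           mat a b c d ≡ mat a' b' c' d'
mat-cong refl refl refl refl = refl

·-assoc : ∀ A B C → (A · B) · C ≡ A · (B · C)
·-assoc (mat a b c d) (mat e f g h) (mat i j k l) =
  mat-cong (entry a b e f g h i k) (entry a b e f g h j l)
           (entry c d e f g h i k) (entry c d e f g h j l)
  where
  entry : ∀ (a b e f g h i k : ℤ) →
          (a * e + b * g) * i + (a * f + b * h) * k ≡ a * (e * i + f * k) + b * (g * i + h * k)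
  entry = solve-∀

·-identityˡ : ∀ A → I₂ · A ≡ A
·-identityˡ (mat a b c d) = mat-cong (top a c) (top b d) (bottom a c) (bottom b d)
  where
  top : ∀ (x y : ℤ) → 1ℤ * x + 0ℤ * y ≡ x
  top = solve-∀
  bottom : ∀ (x y : ℤ) → 0ℤ * x + 1ℤ * y ≡ y
  bottom = solve-∀

·-identityʳ : ∀ A → A · I₂ ≡ A
·-identityʳ (mat a b c d) = mat-cong (left a b) (right a b) (left c d) (right c d)
  where
  left : ∀ (x y : ℤ) → x * 1ℤ + y * 0ℤ ≡ x
  left = solve-∀
  right : ∀ (x y : ℤ) → x * 0ℤ + y * 1ℤ ≡ y
  right = solve-∀

·S : ∀ a b c d → mat a b c d · φL S ≡ mat b (- a) d (- c)
·S a b c d = mat-cong (left a b) (right a b) (left c d) (right c d)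
  where
  left : ∀ (x y : ℤ) → x * 0ℤ + y * 1ℤ ≡ y
  left = solve-∀
  right : ∀ (x y : ℤ) → x * - 1ℤ + y * 0ℤ ≡ - x
  right = solve-∀

·-cancelˡ : ∀ M {A B} → (∃ λ M' → M' · M ≡ I₂) → M · A ≡ M · B → A ≡ B
·-cancelˡ M {A} {B} (M' , M'M≡I) eq = begin
  A              ≡⟨ ·-identityˡ A ⟨
  I₂ · A         ≡⟨ cong (_· A) M'M≡I ⟨
  (M' · M) · A   ≡⟨ ·-assoc M' M A ⟩
  M' · (M · A)   ≡⟨ cong (M' ·_) eq ⟩
  M' · (M · B)   ≡⟨ ·-assoc M' M B ⟨
  (M' · M) · B   ≡⟨ cong (_· B) M'M≡I ⟩
  I₂ · B         ≡⟨ ·-identityˡ B ⟩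
  B              ∎
  where open ≡-Reasoning

·-cancelʳ : ∀ M {A B} → (∃ λ M' → M · M' ≡ I₂) → A · M ≡ B · M → A ≡ B
·-cancelʳ M {A} {B} (M' , MM'≡I) eq = begin
  A              ≡⟨ ·-identityʳ A ⟨
  A · I₂         ≡⟨ cong (A ·_) MM'≡I ⟨
  A · (M · M')   ≡⟨ ·-assoc A M M' ⟨
  (A · M) · M'   ≡⟨ cong (_· M') eq ⟩
  (B · M) · M'   ≡⟨ ·-assoc B M M' ⟩
  B · (M · M')   ≡⟨ cong (B ·_) MM'≡I ⟩
  B · I₂         ≡⟨ ·-identityʳ B ⟩
  B              ∎
  where open ≡-Reasoning

φ-++ : ∀ u v → φ (u ++ v) ≡ φ u · φ v
φ-++ []      v = sym (·-identityˡ (φ v))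
φ-++ (l ∷ u) v = trans (cong (φL l ·_) (φ-++ u v)) (sym (·-assoc (φL l) (φ u) (φ v)))

det-· : ∀ A B → det (A · B) ≡ det A * det B
det-· (mat a b c d) (mat e f g h) = product a b c d e f g h
  where
  product : ∀ (a b c d e f g h : ℤ) →
            (a * e + b * g) * (c * f + d * h) - (a * f + b * h) * (c * e + d * g) ≡
            (a * d - b * c) * (e * h - f * g)
  product = solve-∀

negate : Mat → Mat
negate (mat a b c d) = mat (- a) (- b) (- c) (- d)

negate-·ˡ : ∀ A B → negate A · B ≡ negate (A · B)
negate-·ˡ (mat a b c d) (mat e f g h) =
  mat-cong (entry a b e g) (entry a b f h) (entry c d e g) (entry c d f h)
  where
  entry : ∀ (a b e g : ℤ) → (- a) * e + (- b) * g ≡ - (a * e + b * g)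
  entry = solve-∀

negate-·ʳ : ∀ A B → A · negate B ≡ negate (A · B)
negate-·ʳ (mat a b c d) (mat e f g h) =
  mat-cong (entry a b e g) (entry a b f h) (entry c d e g) (entry c d f h)
  where
  entry : ∀ (a b e g : ℤ) → a * (- e) + b * (- g) ≡ - (a * e + b * g)
  entry = solve-∀

negate-involutive : ∀ A → negate (negate A) ≡ A
negate-involutive (mat a b c d) = mat-cong (twice a) (twice b) (twice c) (twice d)
  where
  twice : ∀ (x : ℤ) → - (- x) ≡ x
  twice = solve-∀

det-negate : ∀ A → det (negate A) ≡ det A
det-negate (mat a b c d) = square a b c d
  where
  square : ∀ (a b c d : ℤ) → (- a) * (- d) - (- b) * (- c) ≡ a * d - b * c
  square = solve-∀

signed : Bool → Mat → Mat
signed false A = A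
signed true  A = negate A

signed-·ˡ : ∀ s A B → signed s A · B ≡ signed s (A · B)
signed-·ˡ false A B = refl
signed-·ˡ true  A B = negate-·ˡ A B

signed-·ʳ : ∀ s A B → A · signed s B ≡ signed s (A · B)
signed-·ʳ false A B = refl
signed-·ʳ true  A B = negate-·ʳ A B

signed-xor : ∀ s t A → signed s (signed t A) ≡ signed (s xor t) A
signed-xor false t     A = refl
signed-xor true  false A = refl
signed-xor true  true  A = negate-involutive A

signed-involutive : ∀ s A → signed s (signed s A) ≡ A
signed-involutive s A = trans (signed-xor s s A) (cong (λ t → signed t A) (xor-same s))

signed-injective : ∀ s {A B} → signed s A ≡ signed s B → A ≡ B
signed-injective s {A} {B} eq =
  trans (sym (signed-involutive s A)) (trans (cong (signed s) eq) (signed-involutive s B))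

signed-negate : ∀ s A → signed s (negate A) ≡ signed (not s) A
signed-negate false A = refl
signed-negate true  A = negate-involutive A

det-signed : ∀ s A → det (signed s A) ≡ det A
det-signed false A = refl
det-signed true  A = det-negate A

-- The factorisation ±R^j·Q·S^e of SL(2,ℤ)

ι : ℕMat → Mat
ι (nmat a b c d) = mat (+ a) (+ b) (+ c) (+ d)

ι-injective : ∀ q q' → ι q ≡ ι q' → q ≡ q'
ι-injective (nmat a b c d) (nmat a' b' c' d') refl = refl

det-ι : ∀ a b c d → det (ι (nmat a b c d)) ≡ + (a ℕ.* d) - + (b ℕ.* c)
det-ι a b c d = sym (cong₂ _-_ (pos-* a d) (pos-* b c))

ι-unimodular : ∀ q → Unimodular q → det (ι q) ≡ 1ℤ
ι-unimodular (nmat a b c d) u = begin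
  det (ι (nmat a b c d))            ≡⟨ det-ι a b c d ⟩
  + (a ℕ.* d) - + (b ℕ.* c)         ≡⟨ cong (λ n → + n - + (b ℕ.* c)) u ⟩
  (1ℤ + + (b ℕ.* c)) - + (b ℕ.* c)  ≡⟨ cancel (+ (b ℕ.* c)) ⟩
  1ℤ                                ∎
  where
  open ≡-Reasoning
  cancel : ∀ x → (1ℤ + x) - x ≡ 1ℤ
  cancel = solve-∀

unimodular-ι : ∀ q → det (ι q) ≡ 1ℤ → Unimodular q
unimodular-ι (nmat a b c d) det≡1 = +-injective (begin
  + (a ℕ.* d)                                ≡⟨ uncancel (+ (a ℕ.* d)) (+ (b ℕ.* c)) ⟩
  (+ (a ℕ.* d) - + (b ℕ.* c)) + + (b ℕ.* c)  ≡⟨ cong (_+ + (b ℕ.* c)) (trans (sym (det-ι a b c d)) det≡1) ⟩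
  1ℤ + + (b ℕ.* c)                           ∎)
  where
  open ≡-Reasoning
  uncancel : ∀ x y → x ≡ (x - y) + y
  uncancel = solve-∀

bit : Bool → ℕ.ℕ
bit false = 0
bit true  = 1

R^ : Fin 3 → Mat
R^ j = φ (pow R (toℕ j))

S^ : Bool → Mat
S^ e = φ (pow S (bit e))

R^-invertible : ∀ j → ∃ λ M → M · R^ j ≡ I₂
R^-invertible 0F = I₂ , refl
R^-invertible 1F = φ (pow R 5) , refl
R^-invertible 2F = φ (pow R 4) , refl

S^-invertible : ∀ e → ∃ λ M → S^ e · M ≡ I₂
S^-invertible false = I₂ , refl
S^-invertible true  = φ (pow S 3) , refl

det-R^ : ∀ j → det (R^ j) ≡ 1ℤ
det-R^ 0F = refl
det-R^ 1F = refl
det-R^ 2F = refl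

det-S^ : ∀ e → det (S^ e) ≡ 1ℤ
det-S^ false = refl
det-S^ true  = refl

slForm : Bool → Fin 3 → ℕMat → Bool → Mat
slForm s j q e = signed s (R^ j · (ι q · S^ e))

det-slForm : ∀ s j q e → det (slForm s j q e) ≡ det (ι q)
det-slForm s j q e = begin
  det (signed s (R^ j · (ι q · S^ e)))   ≡⟨ det-signed s _ ⟩
  det (R^ j · (ι q · S^ e))              ≡⟨ det-· (R^ j) _ ⟩
  det (R^ j) * det (ι q · S^ e)          ≡⟨ cong₂ _*_ (det-R^ j) (det-· (ι q) (S^ e)) ⟩
  1ℤ * (det (ι q) * det (S^ e))          ≡⟨ cong (λ x → 1ℤ * (det (ι q) * x)) (det-S^ e) ⟩
  1ℤ * (det (ι q) * 1ℤ)                  ≡⟨ units (det (ι q)) ⟩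
  det (ι q)                              ∎
  where
  open ≡-Reasoning
  units : ∀ x → 1ℤ * (x * 1ℤ) ≡ x
  units = solve-∀

slForm-cancel : ∀ s j e {q q'} → slForm s j q e ≡ slForm s j q' e → q ≡ q'
slForm-cancel s j e {q} {q'} eq =
  ι-injective q q' (·-cancelʳ (S^ e) (S^-invertible e) (·-cancelˡ (R^ j) (R^-invertible j) (signed-injective s eq)))

-- Sign patterns of columns

data Signum : Set where
  neg zer pos : Signum

_≟ˢ_ : DecidableEquality Signum
neg ≟ˢ neg = yes refl
neg ≟ˢ zer = no λ ()
neg ≟ˢ pos = no λ ()
zer ≟ˢ neg = no λ ()
zer ≟ˢ zer = yes refl
zer ≟ˢ pos = no λ ()
pos ≟ˢ neg = no λ ()
pos ≟ˢ zer = no λ ()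
pos ≟ˢ pos = yes refl

opposite : Signum → Signum
opposite neg = pos
opposite zer = zer
opposite pos = neg

Shape : Set
Shape = Signum × Signum × Signum

signum : ℤ → Signum
signum (+ ℕ.zero)  = zer
signum (+ ℕ.suc _) = pos
signum -[1+ _ ]    = neg

shape : ℤ → ℤ → Shape
shape x y = signum x , signum y , signum (x + y)

shapes : Mat → Shape × Shape
shapes (mat a b c d) = shape a c , shape b d

turn : Shape → Shape
turn (σ , τ , υ) = opposite τ , υ , σ

reflect : Shape → Shape
reflect (σ , τ , υ) = opposite σ , opposite τ , opposite υ

both : (Shape → Shape) → Shape × Shape → Shape × Shape
both f (u , v) = f u , f v

signed-shapes : Bool → Shape × Shape → Shape × Shape
signed-shapes false p = p
signed-shapes true  p = both reflect p

turned : Fin 3 → Shape × Shape → Shape × Shape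
turned 0F p = p
turned 1F p = both turn p
turned 2F p = both turn (both turn p)

positivity : Bool → Signum
positivity false = zer
positivity true  = pos

standard-shapes : Bool → Bool → Bool → Shape × Shape
standard-shapes false β γ = (pos , positivity γ , pos) , (positivity β , pos , pos)
standard-shapes true  β γ = (positivity β , pos , pos) , (neg , opposite (positivity γ) , neg)

signature : Bool → Fin 3 → Bool → Bool → Bool → Shape × Shape
signature s j e β γ = signed-shapes s (turned j (standard-shapes e β γ))

all-Bool? : {P : Bool → Set} → (∀ b → Dec (P b)) → Dec (∀ b → P b)
all-Bool? P? = map′ (λ { (f , t) false → f ; (f , t) true → t }) (λ h → h false , h true) (P? false ×-dec P? true)

-- Decided by evaluation on all 2304 pairs of arguments.
signature-injective : ∀ s j e β γ s' j' e' β' γ' →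
                      signature s j e β γ ≡ signature s' j' e' β' γ' → (s , j , e) ≡ (s' , j' , e')
signature-injective = toWitness {a? = decision} _
  where
  _≟ᵗ_ : DecidableEquality Shape
  _≟ᵗ_ = ≡-dec _≟ˢ_ (≡-dec _≟ˢ_ _≟ˢ_)
  _≟ᵏ_ : DecidableEquality (Bool × Fin 3 × Bool)
  _≟ᵏ_ = ≡-dec Bool._≟_ (≡-dec Fin._≟_ Bool._≟_)
  decision : Dec (∀ s j e β γ s' j' e' β' γ' →
                  signature s j e β γ ≡ signature s' j' e' β' γ' → (s , j , e) ≡ (s' , j' , e'))
  decision =
    all-Bool? λ s → Fin.all? λ j → all-Bool? λ e → all-Bool? λ β → all-Bool? λ γ →
    all-Bool? λ s' → Fin.all? λ j' → all-Bool? λ e' → all-Bool? λ β' → all-Bool? λ γ' →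
    (≡-dec _≟ᵗ_ _≟ᵗ_ (signature s j e β γ) (signature s' j' e' β' γ')) →-dec ((s , j , e) ≟ᵏ (s' , j' , e'))

signum-neg : ∀ x → signum (- x) ≡ opposite (signum x)
signum-neg (+ ℕ.zero)  = refl
signum-neg (+ ℕ.suc _) = refl
signum-neg -[1+ _ ]    = refl

shape-neg : ∀ x y → shape (- x) (- y) ≡ reflect (shape x y)
shape-neg x y = cong₂ _,_ (signum-neg x) (cong₂ _,_ (signum-neg y)
  (trans (cong signum (sym (neg-distrib-+ x y))) (signum-neg (x + y))))

shape-R : ∀ x y → shape (0ℤ * x + - 1ℤ * y) (1ℤ * x + 1ℤ * y) ≡ turn (shape x y)
shape-R x y = trans (cong₂ shape (first x y) (second x y))
  (cong₂ _,_ (signum-neg y) (cong (signum (x + y) ,_) (cong signum (sum x y))))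
  where
  first : ∀ x y → 0ℤ * x + - 1ℤ * y ≡ - y
  first = solve-∀
  second : ∀ x y → 1ℤ * x + 1ℤ * y ≡ x + y
  second = solve-∀
  sum : ∀ x y → - y + (x + y) ≡ x
  sum = solve-∀

shapes-R· : ∀ A → shapes (φL R · A) ≡ both turn (shapes A)
shapes-R· (mat a b c d) = cong₂ _,_ (shape-R a c) (shape-R b d)

shapes-signed : ∀ s A → shapes (signed s A) ≡ signed-shapes s (shapes A)
shapes-signed false A             = refl
shapes-signed true  (mat a b c d) = cong₂ _,_ (shape-neg a c) (shape-neg b d)

shapes-R^ : ∀ j A → shapes (R^ j · A) ≡ turned j (shapes A)
shapes-R^ 0F A = cong shapes (·-identityˡ A)
shapes-R^ 1F A = shapes-R· A
shapes-R^ 2F A = begin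
  shapes ((φL R · φL R) · A)         ≡⟨ cong shapes (·-assoc (φL R) (φL R) A) ⟩
  shapes (φL R · (φL R · A))         ≡⟨ shapes-R· (φL R · A) ⟩
  both turn (shapes (φL R · A))      ≡⟨ cong (both turn) (shapes-R· A) ⟩
  both turn (both turn (shapes A))   ∎
  where open ≡-Reasoning

shapes-ι·S^ : ∀ e a b c d →
              shapes (ι (nmat (ℕ.suc a) b c (ℕ.suc d)) · S^ e) ≡ standard-shapes e (0 ℕ.<ᵇ b) (0 ℕ.<ᵇ c)
shapes-ι·S^ false a b c d = trans (cong shapes (·-identityʳ (ι (nmat (ℕ.suc a) b c (ℕ.suc d))))) (columns b c)
  where
  columns : ∀ b c → shapes (ι (nmat (ℕ.suc a) b c (ℕ.suc d))) ≡ standard-shapes false (0 ℕ.<ᵇ b) (0 ℕ.<ᵇ c)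
  columns ℕ.zero    ℕ.zero    = refl
  columns ℕ.zero    (ℕ.suc _) = refl
  columns (ℕ.suc _) ℕ.zero    = refl
  columns (ℕ.suc _) (ℕ.suc _) = refl
shapes-ι·S^ true  a b c d = trans (cong shapes (·S (+ ℕ.suc a) (+ b) (+ c) (+ ℕ.suc d))) (columns b c)
  where
  columns : ∀ b c → shapes (mat (+ b) (- + ℕ.suc a) (+ ℕ.suc d) (- + c)) ≡ standard-shapes true (0 ℕ.<ᵇ b) (0 ℕ.<ᵇ c)
  columns ℕ.zero    ℕ.zero    = refl
  columns ℕ.zero    (ℕ.suc _) = refl
  columns (ℕ.suc _) ℕ.zero    = refl
  columns (ℕ.suc _) (ℕ.suc _) = refl

shapes-slForm : ∀ s j e q → Unimodular q →
                shapes (slForm s j q e) ≡ signature s j e (0 ℕ.<ᵇ ℕMat.b q) (0 ℕ.<ᵇ ℕMat.c q)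
shapes-slForm s j e (nmat a b c d) u with unimodular-diagonal (nmat a b c d) u
... | ℕ.s≤s {n = a'} _ , ℕ.s≤s {n = d'} _ = begin
  shapes (signed s (R^ j · (ι q · S^ e)))           ≡⟨ shapes-signed s (R^ j · (ι q · S^ e)) ⟩
  signed-shapes s (shapes (R^ j · (ι q · S^ e)))    ≡⟨ cong (signed-shapes s) (shapes-R^ j (ι q · S^ e)) ⟩
  signed-shapes s (turned j (shapes (ι q · S^ e)))  ≡⟨ cong (signed-shapes s ∘ turned j) (shapes-ι·S^ e a' b c d') ⟩
  signature s j e (0 ℕ.<ᵇ b) (0 ℕ.<ᵇ c)             ∎
  where
  open ≡-Reasoning
  q : ℕMat
  q = nmat (ℕ.suc a') b c (ℕ.suc d')

slForm-injective : ∀ s j e q s' j' e' q' → Unimodular q → Unimodular q' →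
                   slForm s j q e ≡ slForm s' j' q' e' → (s , j , e) ≡ (s' , j' , e') × q ≡ q'
slForm-injective s j e q s' j' e' q' u u' eq = same-code , same-tuMat same-code eq
  where
  same-code : (s , j , e) ≡ (s' , j' , e')
  same-code = signature-injective s j e _ _ s' j' e' _ _
    (trans (sym (shapes-slForm s j e q u)) (trans (cong shapes eq) (shapes-slForm s' j' e' q' u')))
  same-tuMat : ∀ {s' j' e'} → (s , j , e) ≡ (s' , j' , e') → slForm s j q e ≡ slForm s' j' q' e' → q ≡ q'
  same-tuMat refl = slForm-cancel s j e

-- Existence of the factorisation

record Decomposition (M : Mat) : Set where
  constructor decomposition
  field
    s : Bool
    j : Fin 3
    P : List Gen
    e : Bool
    slForm≡M : slForm s j (tuMat P) e ≡ M

decompose : ∀ s j e q {M} → slForm s j q e ≡ M → det M ≡ 1ℤ → Decomposition M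
decompose s j e q slForm≡M det≡1 =
  decomposition s j P e (trans (cong (λ q → slForm s j q e) tuMat-P≡q) slForm≡M)
  where
  unimodular : Unimodular q
  unimodular = unimodular-ι q (trans (sym (det-slForm s j q e)) (trans (cong det slForm≡M) det≡1))
  P : List Gen
  P = proj₁ (tuMat-surjective q unimodular)
  tuMat-P≡q : tuMat P ≡ q
  tuMat-P≡q = proj₂ (tuMat-surjective q unimodular)

det-mixed : ∀ a b c d → det (mat (+ a) (- + b) (+ c) (+ d)) ≡ + (a ℕ.* d ℕ.+ b ℕ.* c)
det-mixed a b c d = trans (expand (+ a) (+ b) (+ c) (+ d)) (sym (cong₂ _+_ (pos-* a d) (pos-* b c)))
  where
  expand : ∀ a b c d → a * d - (- b) * c ≡ a * d + b * c
  expand = solve-∀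

det-crossed : ∀ a b c d → det (mat (+ a) (+ b) (+ c) (- + d)) ≡ - + (a ℕ.* d ℕ.+ b ℕ.* c)
det-crossed a b c d =
  trans (expand (+ a) (+ b) (+ c) (+ d)) (sym (cong -_ (cong₂ _+_ (pos-* a d) (pos-* b c))))
  where
  expand : ∀ a b c d → a * (- d) - b * c ≡ - (a * d + b * c)
  expand = solve-∀

negate-R²·ι·S : ∀ b → negate (R^ 2F · (ι (nmat 1 0 b 1) · φL S)) ≡ mat 1ℤ -[1+ b ] 0ℤ 1ℤ
negate-R²·ι·S b = trans (cong (λ A → negate (R^ 2F · A)) (·S 1ℤ 0ℤ (+ b) 1ℤ))
                 (mat-cong refl (top-right (+ b)) refl (bottom-right (+ b)))
  where
  top-right : ∀ x → - ((- 1ℤ) * (- 1ℤ) + (- 1ℤ) * (- x)) ≡ - (1ℤ + x)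
  top-right = solve-∀
  bottom-right : ∀ x → - (1ℤ * (- 1ℤ) + 0ℤ * (- x)) ≡ 1ℤ
  bottom-right = solve-∀

decompose-K₀ : ∀ a b c d → det (mat (+ ℕ.suc a) b (+ c) d) ≡ 1ℤ → Decomposition (mat (+ ℕ.suc a) b (+ c) d)
decompose-K₀ a (+ b) c (+ d) det≡1 =
  decompose false 0F false q (trans (·-identityˡ (ι q · I₂)) (·-identityʳ (ι q))) det≡1
  where
  q : ℕMat
  q = nmat (ℕ.suc a) b c d
decompose-K₀ a -[1+ b ] c -[1+ d ] det≡1 =
  decompose false 0F true q (trans (·-identityˡ (ι q · φL S)) (·S (+ ℕ.suc b) (+ ℕ.suc a) (+ ℕ.suc d) (+ c))) det≡1
  where
  q : ℕMat
  q = nmat (ℕ.suc b) (ℕ.suc a) (ℕ.suc d) c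
decompose-K₀ a (+ b) c -[1+ d ] det≡1 with trans (sym (det-crossed (ℕ.suc a) b c (ℕ.suc d))) det≡1
... | ()
decompose-K₀ a -[1+ b ] c (+ d) det≡1
  with sum-of-products≡1 a b c d (+-injective (trans (sym (det-mixed (ℕ.suc a) (ℕ.suc b) c d)) det≡1))
... | inj₁ (refl , refl , refl) =
  decompose false 0F true q (trans (·-identityˡ (ι q · φL S)) (·S 1ℤ (+ ℕ.suc a) 0ℤ 1ℤ)) det≡1
  where
  q : ℕMat
  q = nmat 1 (ℕ.suc a) 0 1
... | inj₂ (refl , refl , refl) = decompose true 2F true (nmat 1 0 b 1) (negate-R²·ι·S b) det≡1

R⁵ : Mat
R⁵ = φ (pow R 5)

R⁵·R^ : ∀ j → ∃ λ f → ∃ λ j' → R⁵ · R^ j ≡ signed f (R^ j')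
R⁵·R^ 0F = true  , 2F , refl
R⁵·R^ 1F = false , 0F , refl
R⁵·R^ 2F = false , 1F , refl

decompose-R· : ∀ M → Decomposition (φL R · M) → Decomposition M
decompose-R· M (decomposition s j P e slForm≡RM) with R⁵·R^ j
... | f , j' , R⁵R^j≡ = decomposition (s xor f) j' P e (begin
  signed (s xor f) (R^ j' · B)      ≡⟨ signed-xor s f (R^ j' · B) ⟨
  signed s (signed f (R^ j' · B))   ≡⟨ cong (signed s) (signed-·ˡ f (R^ j') B) ⟨
  signed s (signed f (R^ j') · B)   ≡⟨ cong (λ A → signed s (A · B)) R⁵R^j≡ ⟨
  signed s ((R⁵ · R^ j) · B)        ≡⟨ cong (signed s) (·-assoc R⁵ (R^ j) B) ⟩
  signed s (R⁵ · (R^ j · B))        ≡⟨ signed-·ʳ s R⁵ (R^ j · B) ⟨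
  R⁵ · slForm s j (tuMat P) e       ≡⟨ cong (R⁵ ·_) slForm≡RM ⟩
  R⁵ · (φL R · M)                   ≡⟨ ·-assoc R⁵ (φL R) M ⟨
  (R⁵ · φL R) · M                   ≡⟨ ·-identityˡ M ⟩
  M                                 ∎)
  where
  open ≡-Reasoning
  B : Mat
  B = ι (tuMat P) · S^ e

data InK₀ : Shape → Set where
  axis     : InK₀ (pos , zer , pos)
  interior : InK₀ (pos , pos , pos)

turn^ : ℕ.ℕ → Shape → Shape
turn^ ℕ.zero    t = t
turn^ (ℕ.suc n) t = turn^ n (turn t)

turn-into-K₀ : ∀ a c → ¬ (a ≡ 0ℤ × c ≡ 0ℤ) → ∃ λ n → InK₀ (turn^ n (shape a c))
turn-into-K₀ (+ ℕ.zero)  (+ ℕ.zero)  nonzero = ⊥-elim (nonzero (refl , refl))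
turn-into-K₀ (+ ℕ.zero)  (+ ℕ.suc n) nonzero = 5 , axis
turn-into-K₀ (+ ℕ.zero)  -[1+ n ]    nonzero = 2 , axis
turn-into-K₀ (+ ℕ.suc m) (+ ℕ.zero)  nonzero = 0 , axis
turn-into-K₀ (+ ℕ.suc m) (+ ℕ.suc n) nonzero = 0 , interior
turn-into-K₀ -[1+ m ]    (+ ℕ.zero)  nonzero = 3 , axis
turn-into-K₀ -[1+ m ]    -[1+ n ]    nonzero = 3 , interior
turn-into-K₀ (+ ℕ.suc m) -[1+ n ]    nonzero with signum (+ ℕ.suc m + -[1+ n ])
... | neg = 2 , interior
... | zer = 1 , axis
... | pos = 1 , interior
turn-into-K₀ -[1+ m ]    (+ ℕ.suc n) nonzero with signum (-[1+ m ] + + ℕ.suc n)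
... | neg = 4 , interior
... | zer = 4 , axis
... | pos = 5 , interior

det-R· : ∀ M → det (φL R · M) ≡ det M
det-R· M = trans (det-· (φL R) M) (*-identityˡ (det M))

decompose-by-turning : ∀ n a b c d → InK₀ (turn^ n (shape a c)) → det (mat a b c d) ≡ 1ℤ →
                       Decomposition (mat a b c d)
decompose-by-turning ℕ.zero (+ ℕ.suc a) b (+ c)    d _  det≡1 = decompose-K₀ a b c d det≡1
decompose-by-turning ℕ.zero (+ ℕ.zero)  b c        d () _
decompose-by-turning ℕ.zero -[1+ a ]    b c        d () _
decompose-by-turning ℕ.zero (+ ℕ.suc a) b -[1+ c ] d () _
decompose-by-turning (ℕ.suc n) a b c d k det≡1 =
  decompose-R· (mat a b c d)
    (decompose-by-turning n _ _ _ _ (subst (InK₀ ∘ turn^ n) (sym (shape-R a c)) k)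
      (trans (det-R· (mat a b c d)) det≡1))

slForm-surjective : ∀ M → det M ≡ 1ℤ → Decomposition M
slForm-surjective (mat a b c d) det≡1 =
  let n , k = turn-into-K₀ a c nonzero in decompose-by-turning n a b c d k det≡1
  where
  det-zero-column : ∀ b d → 0ℤ * d - b * 0ℤ ≡ 0ℤ
  det-zero-column = solve-∀
  0ℤ≢1ℤ : 0ℤ ≢ 1ℤ
  0ℤ≢1ℤ ()
  nonzero : ¬ (a ≡ 0ℤ × c ≡ 0ℤ)
  nonzero (refl , refl) = 0ℤ≢1ℤ (trans (sym (det-zero-column b d)) det≡1)

record Coordinates : Set where
  constructor coordinates
  field
    δ s : Bool
    j   : Fin 3
    P   : List Gen
    e   : Bool

N^ : Bool → Mat
N^ δ = φ (pow N (bit δ))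

toMat : Coordinates → Mat
toMat (coordinates δ s j P e) = N^ δ · slForm s j (tuMat P) e

N^-invertible : ∀ δ → ∃ λ M → M · N^ δ ≡ I₂
N^-invertible false = I₂ , refl
N^-invertible true  = φL N , refl

±1 : Bool → ℤ
±1 false = 1ℤ
±1 true  = - 1ℤ

±1-injective : ∀ δ δ' → ±1 δ ≡ ±1 δ' → δ ≡ δ'
±1-injective false false _ = refl
±1-injective true  true  _ = refl
±1-injective false true  ()
±1-injective true  false ()

det-toMat : ∀ x → det (toMat x) ≡ ±1 (Coordinates.δ x)
det-toMat (coordinates δ s j P e) = begin
  det (N^ δ · slForm s j (tuMat P) e)        ≡⟨ det-· (N^ δ) (slForm s j (tuMat P) e) ⟩
  det (N^ δ) * det (slForm s j (tuMat P) e)  ≡⟨ cong (det (N^ δ) *_) (det-slForm s j (tuMat P) e) ⟩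
  det (N^ δ) * det (ι (tuMat P))             ≡⟨ cong (det (N^ δ) *_) (ι-unimodular (tuMat P) (tuMat-unimodular P)) ⟩
  det (N^ δ) * 1ℤ                            ≡⟨ det-N^ δ ⟩
  ±1 δ                                       ∎
  where
  open ≡-Reasoning
  det-N^ : ∀ δ → det (N^ δ) * 1ℤ ≡ ±1 δ
  det-N^ false = refl
  det-N^ true  = refl

toMat-injective : ∀ x y → toMat x ≡ toMat y → x ≡ y
toMat-injective x@(coordinates δ s j P e) y@(coordinates δ' s' j' P' e') eq =
  same-δ (±1-injective δ δ' (trans (sym (det-toMat x)) (trans (cong det eq) (det-toMat y)))) eq
  where
  same-δ : ∀ {δ'} → δ ≡ δ' → toMat x ≡ toMat (coordinates δ' s' j' P' e') → x ≡ coordinates δ' s' j' P' e'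
  same-δ refl eq = same-rest (slForm-injective s j e (tuMat P) s' j' e' (tuMat P')
                                (tuMat-unimodular P) (tuMat-unimodular P') (·-cancelˡ (N^ δ) (N^-invertible δ) eq))
    where
    same-rest : ∀ {s' j' e'} → (s , j , e) ≡ (s' , j' , e') × tuMat P ≡ tuMat P' → x ≡ coordinates δ s' j' P' e'
    same-rest (refl , tuMat-P≡tuMat-P') = cong (λ P → coordinates δ s j P e) (tuMat-injective P P' tuMat-P≡tuMat-P')

toMat-surjective : ∀ M → InGL2 M → ∃ λ x → toMat x ≡ M
toMat-surjective M (inj₁ det≡1) =
  let decomposition s j P e slForm≡M = slForm-surjective M det≡1 in
  coordinates false s j P e , trans (·-identityˡ (slForm s j (tuMat P) e)) slForm≡M
toMat-surjective M (inj₂ det≡-1) =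
  let decomposition s j P e slForm≡NM = slForm-surjective (φL N · M) det-NM≡1 in
  coordinates true s j P e , trans (cong (φL N ·_) slForm≡NM) (N·N· M)
  where
  det-NM≡1 : det (φL N · M) ≡ 1ℤ
  det-NM≡1 = trans (det-· (φL N) M) (cong (- 1ℤ *_) det≡-1)
  N·N· : ∀ A → φL N · (φL N · A) ≡ A
  N·N· A = trans (sym (·-assoc (φL N) (φL N) A)) (·-identityˡ A)

-- Canonical words

exponent : Gen → ℕ.ℕ
exponent T = 1
exponent U = 2

trailing : Bool → List ℕ.ℕ
trailing false = []
trailing true  = 0 ∷ []

exponents : List Gen → Bool → List ℕ.ℕ
exponents P e = map exponent P ++ trailing e

parity : List Gen → Bool
parity []      = false
parity (_ ∷ P) = not (parity P)

-- Without a leading S the exponent α₀ is the rotation j; for j = 0 a nonempty tail starts with S.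
assemble : Bool → Bool → Fin 3 → List ℕ.ℕ → Word
assemble δ γ 0F []       = canonicalWord (bit δ) (bit γ) 0 0 []
assemble δ γ 0F (α ∷ αs) = canonicalWord (bit δ) (bit γ) 1 α αs
assemble δ γ 1F αs       = canonicalWord (bit δ) (bit γ) 0 1 αs
assemble δ γ 2F αs       = canonicalWord (bit δ) (bit γ) 0 2 αs

toWord : Coordinates → Word
toWord (coordinates δ s j P e) = assemble δ (s xor parity P) j (exponents P e)

assemble-unfold : ∀ δ γ j αs →
                  assemble δ γ j αs ≡ pow N (bit δ) ++ pow X (bit γ) ++ pow R (toℕ j) ++ sTail αs
assemble-unfold δ γ 0F []       = refl
assemble-unfold δ γ 0F (α ∷ αs) = refl
assemble-unfold δ γ 1F αs       = refl
assemble-unfold δ γ 2F αs       = refl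

sTail-++ : ∀ αs βs → sTail (αs ++ βs) ≡ sTail αs ++ sTail βs
sTail-++ []       βs = refl
sTail-++ (α ∷ αs) βs =
  cong (S ∷_) (trans (cong (pow R α ++_) (sTail-++ αs βs)) (sym (++-assoc (pow R α) (sTail αs) (sTail βs))))

φ-X^ : ∀ γ A → φ (pow X (bit γ)) · A ≡ signed γ A
φ-X^ false A             = ·-identityˡ A
φ-X^ true  (mat a b c d) = mat-cong (top a c) (top b d) (bottom a c) (bottom b d)
  where
  top : ∀ (x y : ℤ) → (- 1ℤ) * x + 0ℤ * y ≡ - x
  top = solve-∀
  bottom : ∀ (x y : ℤ) → 0ℤ * x + (- 1ℤ) * y ≡ - y
  bottom = solve-∀

S·R·ι : ∀ q → φL S · (φL R · ι q) ≡ negate (ι (T· q))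
S·R·ι (nmat a b c d) =
  mat-cong (top (+ a) (+ c)) (top (+ b) (+ d)) (bottom (+ a) (+ c)) (bottom (+ b) (+ d))
  where
  top : ∀ x y → 0ℤ * (0ℤ * x + (- 1ℤ) * y) + (- 1ℤ) * (1ℤ * x + 1ℤ * y) ≡ - (y + x)
  top = solve-∀
  bottom : ∀ x y → 1ℤ * (0ℤ * x + (- 1ℤ) * y) + 0ℤ * (1ℤ * x + 1ℤ * y) ≡ - y
  bottom = solve-∀

S·R·R·ι : ∀ q → φL S · (φL R · (φL R · ι q)) ≡ negate (ι (U· q))
S·R·R·ι (nmat a b c d) =
  mat-cong (top (+ a) (+ c)) (top (+ b) (+ d)) (bottom (+ a) (+ c)) (bottom (+ b) (+ d))
  where
  top : ∀ x y → 0ℤ * (0ℤ * (0ℤ * x + (- 1ℤ) * y) + (- 1ℤ) * (1ℤ * x + 1ℤ * y))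
                + (- 1ℤ) * (1ℤ * (0ℤ * x + (- 1ℤ) * y) + 1ℤ * (1ℤ * x + 1ℤ * y)) ≡ - x
  top = solve-∀
  bottom : ∀ x y → 1ℤ * (0ℤ * (0ℤ * x + (- 1ℤ) * y) + (- 1ℤ) * (1ℤ * x + 1ℤ * y))
                   + 0ℤ * (1ℤ * (0ℤ * x + (- 1ℤ) * y) + 1ℤ * (1ℤ * x + 1ℤ * y)) ≡ - (x + y)
  bottom = solve-∀

φ-blocks : ∀ P → φ (sTail (map exponent P)) ≡ signed (parity P) (ι (tuMat P))
φ-blocks []      = refl
φ-blocks (T ∷ P) = begin
  φL S · (φL R · φ (sTail (map exponent P)))        ≡⟨ cong (λ A → φL S · (φL R · A)) (φ-blocks P) ⟩
  φL S · (φL R · signed p (ι (tuMat P)))            ≡⟨ cong (φL S ·_) (signed-·ʳ p (φL R) _) ⟩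
  φL S · signed p (φL R · ι (tuMat P))              ≡⟨ signed-·ʳ p (φL S) _ ⟩
  signed p (φL S · (φL R · ι (tuMat P)))            ≡⟨ cong (signed p) (S·R·ι (tuMat P)) ⟩
  signed p (negate (ι (T· tuMat P)))                ≡⟨ signed-negate p _ ⟩
  signed (not p) (ι (T· tuMat P))                   ∎
  where
  open ≡-Reasoning
  p : Bool
  p = parity P
φ-blocks (U ∷ P) = begin
  φL S · (φL R · (φL R · φ (sTail (map exponent P))))  ≡⟨ cong (λ A → φL S · (φL R · (φL R · A))) (φ-blocks P) ⟩
  φL S · (φL R · (φL R · signed p (ι (tuMat P))))      ≡⟨ cong (λ A → φL S · (φL R · A)) (signed-·ʳ p (φL R) _) ⟩
  φL S · (φL R · signed p (φL R · ι (tuMat P)))        ≡⟨ cong (φL S ·_) (signed-·ʳ p (φL R) _) ⟩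
  φL S · signed p (φL R · (φL R · ι (tuMat P)))        ≡⟨ signed-·ʳ p (φL S) _ ⟩
  signed p (φL S · (φL R · (φL R · ι (tuMat P))))      ≡⟨ cong (signed p) (S·R·R·ι (tuMat P)) ⟩
  signed p (negate (ι (U· tuMat P)))                   ≡⟨ signed-negate p _ ⟩
  signed (not p) (ι (U· tuMat P))                      ∎
  where
  open ≡-Reasoning
  p : Bool
  p = parity P

φ-exponents : ∀ P e → φ (sTail (exponents P e)) ≡ signed (parity P) (ι (tuMat P) · S^ e)
φ-exponents P e = begin
  φ (sTail (map exponent P ++ trailing e))              ≡⟨ cong φ (sTail-++ (map exponent P) (trailing e)) ⟩
  φ (sTail (map exponent P) ++ sTail (trailing e))      ≡⟨ φ-++ (sTail (map exponent P)) (sTail (trailing e)) ⟩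
  φ (sTail (map exponent P)) · φ (sTail (trailing e))   ≡⟨ cong₂ _·_ (φ-blocks P) (φ-trailing e) ⟩
  signed (parity P) (ι (tuMat P)) · S^ e                ≡⟨ signed-·ˡ (parity P) (ι (tuMat P)) (S^ e) ⟩
  signed (parity P) (ι (tuMat P) · S^ e)                ∎
  where
  open ≡-Reasoning
  φ-trailing : ∀ e → φ (sTail (trailing e)) ≡ S^ e
  φ-trailing false = refl
  φ-trailing true  = refl

xor-cancelʳ : ∀ s p → (s xor p) xor p ≡ s
xor-cancelʳ s p = trans (xor-assoc s p p) (trans (cong (s xor_) (xor-same p)) (xor-identityʳ s))

φ-toWord : ∀ x → φ (toWord x) ≡ toMat x
φ-toWord (coordinates δ s j P e) = begin
  φ (assemble δ γ j αs)                                              ≡⟨ cong φ (assemble-unfold δ γ j αs) ⟩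
  φ (pow N (bit δ) ++ pow X (bit γ) ++ pow R (toℕ j) ++ sTail αs)    ≡⟨ φ-++ (pow N (bit δ)) _ ⟩
  N^ δ · φ (pow X (bit γ) ++ pow R (toℕ j) ++ sTail αs)              ≡⟨ cong (N^ δ ·_) (trans (φ-++ (pow X (bit γ)) _) (φ-X^ γ _)) ⟩
  N^ δ · signed γ (φ (pow R (toℕ j) ++ sTail αs))                    ≡⟨ cong (λ A → N^ δ · signed γ A) (φ-++ (pow R (toℕ j)) (sTail αs)) ⟩
  N^ δ · signed γ (R^ j · φ (sTail αs))                              ≡⟨ cong (λ A → N^ δ · signed γ (R^ j · A)) (φ-exponents P e) ⟩
  N^ δ · signed γ (R^ j · signed p (ι (tuMat P) · S^ e))             ≡⟨ cong (λ A → N^ δ · signed γ A) (signed-·ʳ p (R^ j) _) ⟩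
  N^ δ · signed γ (signed p (R^ j · (ι (tuMat P) · S^ e)))           ≡⟨ cong (N^ δ ·_) (signed-xor γ p _) ⟩
  N^ δ · slForm (γ xor p) j (tuMat P) e                              ≡⟨ cong (λ t → N^ δ · slForm t j (tuMat P) e) (xor-cancelʳ s p) ⟩
  N^ δ · slForm s j (tuMat P) e                                      ∎
  where
  open ≡-Reasoning
  p : Bool
  p = parity P
  γ : Bool
  γ = s xor p
  αs : List ℕ.ℕ
  αs = exponents P e

ValidTail : List ℕ.ℕ → Set
ValidTail αs = αs ≡ [] ⊎ ValidExps αs

valid-cons : ∀ {α αs} → 1 ℕ.≤ α → α ℕ.< 3 → ValidTail αs → ValidExps (α ∷ αs)
valid-cons 1≤α α<3 (inj₁ refl) = last α<3
valid-cons 1≤α α<3 (inj₂ v)    = cons 1≤α α<3 v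

valid-tail : ∀ {α αs} → ValidExps (α ∷ αs) → ValidTail αs
valid-tail (last _)     = inj₁ refl
valid-tail (cons _ _ v) = inj₂ v

exponents-valid : ∀ P e → ValidTail (exponents P e)
exponents-valid []      false = inj₁ refl
exponents-valid []      true  = inj₂ (last ℕ.z<s)
exponents-valid (T ∷ P) e     = inj₂ (valid-cons ℕ.z<s (ℕ.s<s ℕ.z<s) (exponents-valid P e))
exponents-valid (U ∷ P) e     = inj₂ (valid-cons ℕ.z<s (ℕ.s<s (ℕ.s<s ℕ.z<s)) (exponents-valid P e))

pattern 3+_ n = ℕ.suc (ℕ.suc (ℕ.suc n))

exponents-surjective : ∀ {αs} → ValidTail αs → ∃ λ P → ∃ λ e → exponents P e ≡ αs
exponents-surjective (inj₁ refl)             = [] , false , refl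
exponents-surjective (inj₂ (last {0} _))     = [] , true , refl
exponents-surjective (inj₂ (last {1} _))     = T ∷ [] , false , refl
exponents-surjective (inj₂ (last {2} _))     = U ∷ [] , false , refl
exponents-surjective (inj₂ (cons {1} _ _ v)) =
  let P , e , eq = exponents-surjective (inj₂ v) in T ∷ P , e , cong (1 ∷_) eq
exponents-surjective (inj₂ (cons {2} _ _ v)) =
  let P , e , eq = exponents-surjective (inj₂ v) in U ∷ P , e , cong (2 ∷_) eq
exponents-surjective (inj₂ (last {3+ _} (ℕ.s<s (ℕ.s<s (ℕ.s<s ())))))
exponents-surjective (inj₂ (cons {0} () _ _))
exponents-surjective (inj₂ (cons {3+ _} _ (ℕ.s<s (ℕ.s<s (ℕ.s<s ()))) _))

bit<2 : ∀ b → bit b ℕ.< 2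
bit<2 false = ℕ.z<s
bit<2 true  = ℕ.s<s ℕ.z<s

bit-surjective : ∀ {n} → n ℕ.< 2 → ∃ λ b → bit b ≡ n
bit-surjective {0} _ = false , refl
bit-surjective {1} _ = true  , refl
bit-surjective {ℕ.suc (ℕ.suc _)} (ℕ.s<s (ℕ.s<s ()))

assemble-canonical : ∀ δ γ j αs → ValidTail αs → Canonical (assemble δ γ j αs)
assemble-canonical δ γ 0F []       _        =
  bit δ , bit γ , 0 , 0 , [] , bit<2 δ , bit<2 γ , ℕ.z<s , last ℕ.z<s , refl
assemble-canonical δ γ 0F (α ∷ αs) (inj₂ v) =
  bit δ , bit γ , 1 , α , αs , bit<2 δ , bit<2 γ , ℕ.s<s ℕ.z<s , v , refl
assemble-canonical δ γ 1F αs       t        =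
  bit δ , bit γ , 0 , 1 , αs , bit<2 δ , bit<2 γ , ℕ.z<s , valid-cons ℕ.z<s (ℕ.s<s ℕ.z<s) t , refl
assemble-canonical δ γ 2F αs       t        =
  bit δ , bit γ , 0 , 2 , αs , bit<2 δ , bit<2 γ , ℕ.z<s , valid-cons ℕ.z<s (ℕ.s<s (ℕ.s<s ℕ.z<s)) t , refl

toWord-canonical : ∀ x → Canonical (toWord x)
toWord-canonical (coordinates δ s j P e) =
  assemble-canonical δ (s xor parity P) j (exponents P e) (exponents-valid P e)

canonical⇒assemble : ∀ w → Canonical w →
                     ∃ λ δ → ∃ λ γ → ∃ λ j → ∃ λ αs → ValidTail αs × assemble δ γ j αs ≡ w
canonical⇒assemble w (δ , γ , β , α₀ , αs , δ<2 , γ<2 , β<2 , v , eq) with bit-surjective δ<2 | bit-surjective γ<2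
... | δ′ , refl | γ′ , refl = by-β β α₀ β<2 v eq
  where
  by-β : ∀ β α₀ {αs} → β ℕ.< 2 → ValidExps (α₀ ∷ αs) → canonicalWord (bit δ′) (bit γ′) β α₀ αs ≡ w →
         ∃ λ δ → ∃ λ γ → ∃ λ j → ∃ λ αs → ValidTail αs × assemble δ γ j αs ≡ w
  by-β 0 0  _ (last _) eq = δ′ , γ′ , 0F , [] , inj₁ refl , eq
  by-β 0 1  _ v        eq = δ′ , γ′ , 1F , _ , valid-tail v , eq
  by-β 0 2  _ v        eq = δ′ , γ′ , 2F , _ , valid-tail v , eq
  by-β 1 α₀ _ v        eq = δ′ , γ′ , 0F , α₀ ∷ _ , inj₂ v , eq
  by-β 0 0  _ (cons () _ _)
  by-β 0 (3+ _) _ (last (ℕ.s<s (ℕ.s<s (ℕ.s<s ()))))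
  by-β 0 (3+ _) _ (cons _ (ℕ.s<s (ℕ.s<s (ℕ.s<s ()))) _)
  by-β (ℕ.suc (ℕ.suc _)) _ (ℕ.s<s (ℕ.s<s ())) _

canonical⇒toWord : ∀ w → Canonical w → ∃ λ x → toWord x ≡ w
canonical⇒toWord w canonical =
  let δ , γ , j , αs , valid , assemble≡w = canonical⇒assemble w canonical
      P , e , exponents≡αs = exponents-surjective valid
  in coordinates δ (γ xor parity P) j P e ,
     trans (cong₂ (λ γ αs → assemble δ γ j αs) (xor-cancelʳ γ (parity P)) exponents≡αs) assemble≡w

corollary1 : (M : Mat) → InGL2 M →
    Σ Word λ w → (Canonical w × φ w ≡ M) ×
      ((w' : Word) → Canonical w' → φ w' ≡ M → w' ≡ w)
corollary1 M M∈GL = toWord x , (toWord-canonical x , trans (φ-toWord x) toMat-x≡M) , unique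
  where
  x : Coordinates
  x = proj₁ (toMat-surjective M M∈GL)
  toMat-x≡M : toMat x ≡ M
  toMat-x≡M = proj₂ (toMat-surjective M M∈GL)
  unique : (w' : Word) → Canonical w' → φ w' ≡ M → w' ≡ toWord x
  unique w' canonical φw'≡M =
    let x' , toWord-x'≡w' = canonical⇒toWord w' canonical
        toMat-x'≡M = trans (sym (φ-toWord x')) (trans (cong φ toWord-x'≡w') φw'≡M)
    in trans (sym toWord-x'≡w') (cong toWord (toMat-injective x' x (trans toMat-x'≡M (sym toMat-x≡M))))
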